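{- Let $H$ be a hypergraph and $p\in(0,1)$. If $b_{L,p}(H)=1$, then $b_p(H)\leq |E(H)|+1$.
   Context: A hypergraph $H=(V(H),E(H))$ has a finite nonempty vertex set and a finite collection $E(H)$ of subsets of $V(H)$ called edges (parallel edges allowed). Fix a proportion $p\in(0,1)$. Proportion-based propagation rule: if at the end of a round at least $\lceil p|e|\rceil$ vertices of an edge $e$ are on fire, then in the next round all vertices of $e$ catch fire; burned vertices stay burned. Burning game: let $F_0=\emptyset$ and $F_r$ be the set of burned vertices at the end of round $r$. In each round $r\geq 1$, simultaneously, vertices catch fire by propagation from $F_{r-1}$ (no propagation in round 1), and a player chooses a vertex $u_r\notin F_{r-1}$ (a source) and sets it on fire. A burning sequence is a sequence $(u_1,\ldots,u_k)$ of such sources after which every vertex is on fire at the end of round $k$; $b_p(H)$ is the minimum length of a burning sequence. Lazy game: $S\subseteq V(H)$ is a lazy burning set if, setting all of $S$ on fire at once and then repeatedly applying the propagation rule, every vertex eventually catches fire; $b_{L,p}(H)$ is the minimum size of a lazy burning set.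
   Formalization: The proportion p ranges only over the rationals in (0,1). -}

module Defs where

open import Data.Nat as ℕ using (ℕ; zero; suc)
open import Data.Integer as ℤ using (ℤ; +_)
open import Data.Rational as ℚ using (ℚ; _/_; ceiling)
open import Data.Fin using (Fin)
open import Data.Fin.Subset using (Subset; ⊥; ⊤; ⁅_⁆; _∩_; _∪_; ⋃; ∣_∣; _∉_)
open import Data.List using (List; []; _∷_; length; filter)
open import Data.Product using (_×_; Σ; ∃; ∃-syntax)
open import Data.Unit using () renaming (⊤ to Unit)
open import Relation.Binary.PropositionalEquality using (_≡_)

-- A hypergraph: vertex set Fin n with n ≥ 1 (finite, nonempty), and a finite
-- collection of edges (subsets of the vertex set) given as a list, so that
-- parallel edges are allowed.
record Hypergraph : Set where
  field
    n        : ℕ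
    nonempty : 1 ℕ.≤ n
    edges    : List (Subset n)
open Hypergraph public

module _ (p : ℚ) (H : Hypergraph) where

  V : Set
  V = Fin (n H)

  threshold : Subset (n H) → ℤ
  threshold e = ceiling (p ℚ.* ((+ ∣ e ∣) / 1))

  propagate : Subset (n H) → Subset (n H)
  propagate F = F ∪ ⋃ (filter (λ e → threshold e ℤ.≤? + ∣ e ∩ F ∣) (edges H))

  -- Burning game.  Round 1: no propagation, only the source u₁ is set on fire.
  -- Round r ≥ 2: F_r = propagate(F_{r-1}) ∪ {u_r}.
  roundsFrom : Subset (n H) → List V → Subset (n H)
  roundsFrom F []       = F
  roundsFrom F (u ∷ us) = roundsFrom (propagate F ∪ ⁅ u ⁆) us

  legalFrom : Subset (n H) → List V → Set
  legalFrom F []       = Unit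
  legalFrom F (u ∷ us) = (u ∉ F) × legalFrom (propagate F ∪ ⁅ u ⁆) us

  burnedAfter : List V → Subset (n H)
  burnedAfter []       = ⊥
  burnedAfter (u ∷ us) = roundsFrom ⁅ u ⁆ us

  legal : List V → Set
  legal []       = Unit
  legal (u ∷ us) = (u ∉ ⊥) × legalFrom ⁅ u ⁆ us

  IsBurningSequence : List V → Set
  IsBurningSequence us = legal us × (burnedAfter us ≡ ⊤)

  burningNumber≤ : ℕ → Set
  burningNumber≤ k = ∃[ us ] (IsBurningSequence us × length us ℕ.≤ k)

  iter : ℕ → Subset (n H) → Subset (n H)
  iter zero    F = F
  iter (suc k) F = propagate (iter k F)

  IsLazyBurningSet : Subset (n H) → Set
  IsLazyBurningSet S = ∃[ k ] (iter k S ≡ ⊤)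

  lazyBurningNumber≡ : ℕ → Set
  lazyBurningNumber≡ m =
    (∃[ S ] (IsLazyBurningSet S × ∣ S ∣ ≡ m)) ×
    (∀ S → IsLazyBurningSet S → m ℕ.≤ ∣ S ∣)

{-# OPTIONS --safe #-}
-- Burn the unique vertex v of a lazy burning set first.  While some vertex is
-- unburned, the burned set F contains v, so F is not closed under propagation
-- (the closure of {v} is everything): some edge that reaches its threshold in F
-- still has an unburned vertex, and it is completely on fire one round later.
-- Thus every further round increases the number of completely burned edges,
-- and at most |E(H)| further sources are needed.
module Submission where

open import Defs
open import Data.Nat using (suc)
open import Data.List using (length)
open import Data.Rational using (ℚ; 0ℚ; 1ℚ; _<_)

open import Data.Fin using (Fin; zero; suc)
open import Data.Fin.Properties using (any?)
open import Data.Fin.Subset as Subset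
  using (Subset; inside; outside; _∈_; _∉_; _⊆_; _∪_; _∩_; ⋃; ⁅_⁆; ∣_∣)
open import Data.Fin.Subset.Properties
open import Data.Integer as ℤ using (+_)
open import Data.Integer.Properties as ℤ using ()
open import Data.List using ([]; _∷_; filter)
open import Data.List.Membership.Propositional using () renaming (_∈_ to _∈ₗ_)
open import Data.List.Membership.Propositional.Properties using (∈-filter⁺; ∈-filter⁻)
open import Data.List.Properties using (length-filter; filter-accept; filter-reject)
open import Data.List.Relation.Binary.Sublist.Heterogeneous.Properties
  using (length-mono-≤; ⊆-filter-Sublist)
import Data.List.Relation.Binary.Sublist.Propositional as Sublist
open import Data.List.Relation.Unary.Any using (here; there)
open import Data.Nat as ℕ using (ℕ; zero; _+_; _≤_; z≤n; s≤s)
open import Data.Nat.Properties as ℕ using (module ≤-Reasoning)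
open import Data.Product using (_×_; _,_; ∃-syntax)
open import Data.Sum using (_⊎_; inj₁; inj₂)
open import Data.Unit using (tt)
open import Function using (_∘_)
open import Data.Vec.Base using ([]; _∷_)
open import Relation.Nullary using (¬_; yes; no; contradiction; ¬?)
open import Relation.Nullary.Decidable using (decidable-stable; _×-dec_)
open import Relation.Unary as U using (Pred)
open import Relation.Binary.PropositionalEquality using (_≡_; refl; cong; sym; subst)

module _ {a p q} {A : Set a} {P : Pred A p} {Q : Pred A q}
         (P? : U.Decidable P) (Q? : U.Decidable Q) (P⇒Q : ∀ {x} → P x → Q x) where

  length-filter-mono : ∀ xs → length (filter P? xs) ≤ length (filter Q? xs)
  length-filter-mono xs =
    length-mono-≤ (⊆-filter-Sublist P? Q? (λ { refl → P⇒Q }) (Sublist.⊆-refl {x = xs}))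

  length-filter-< : ∀ {x xs} → x ∈ₗ xs → Q x → ¬ P x →
                    length (filter P? xs) ℕ.< length (filter Q? xs)
  length-filter-< {x} {_ ∷ xs} (here refl) qx ¬px
    rewrite filter-reject P? {x} {xs} ¬px | filter-accept Q? {x} {xs} qx =
      s≤s (length-filter-mono xs)
  length-filter-< {xs = y ∷ _} (there x∈xs) qx ¬px
    with ih ← length-filter-< x∈xs qx ¬px | P? y | Q? y
  ... | yes _  | yes _  = s≤s ih
  ... | yes py | no ¬qy = contradiction (P⇒Q py) ¬qy
  ... | no _   | yes _  = ℕ.m<n⇒m<1+n ih
  ... | no _   | no _   = ih

⊆-or-∉ : ∀ {n} (A B : Subset n) → A ⊆ B ⊎ ∃[ x ] (x ∈ A × x ∉ B)
⊆-or-∉ A B with any? (λ x → x ∈? A ×-dec ¬? (x ∈? B))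
... | yes witness = inj₂ witness
... | no none     = inj₁ λ {x} x∈A → decidable-stable (x ∈? B) λ x∉B → none (x , x∈A , x∉B)

≡⊤-or-∉ : ∀ {n} (F : Subset n) → F ≡ Subset.⊤ ⊎ ∃[ x ] x ∉ F
≡⊤-or-∉ F with ⊆-or-∉ Subset.⊤ F
... | inj₁ ⊤⊆F            = inj₁ (⊆-antisym (λ _ → ∈⊤) ⊤⊆F)
... | inj₂ (x , _ , x∉F) = inj₂ (x , x∉F)

∣p∣≡0⇒p≡⊥ : ∀ {n} {p : Subset n} → ∣ p ∣ ≡ 0 → p ≡ Subset.⊥
∣p∣≡0⇒p≡⊥ {p = []}          _    = refl
∣p∣≡0⇒p≡⊥ {p = outside ∷ p} ∣p∣≡0 = cong (outside ∷_) (∣p∣≡0⇒p≡⊥ ∣p∣≡0)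

∣p∣≡1⇒p≡⁅x⁆ : ∀ {n} (p : Subset n) → ∣ p ∣ ≡ 1 → ∃[ x ] p ≡ ⁅ x ⁆
∣p∣≡1⇒p≡⁅x⁆ (inside ∷ p)  ∣p∣≡1 = zero , cong (inside ∷_) (∣p∣≡0⇒p≡⊥ (ℕ.suc-injective ∣p∣≡1))
∣p∣≡1⇒p≡⁅x⁆ (outside ∷ p) ∣p∣≡1 with x , p≡⁅x⁆ ← ∣p∣≡1⇒p≡⁅x⁆ p ∣p∣≡1 =
  suc x , cong (outside ∷_) p≡⁅x⁆

x∈⋃⁺ : ∀ {n} {x : Fin n} {p ps} → p ∈ₗ ps → x ∈ p → x ∈ ⋃ ps
x∈⋃⁺ {ps = _ ∷ ps} (here refl) x∈p = p⊆p∪q (⋃ ps) x∈p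
x∈⋃⁺ {ps = p ∷ _}  (there p∈ps) x∈p = q⊆p∪q p _ (x∈⋃⁺ p∈ps x∈p)

x∈⋃⁻ : ∀ {n} {x : Fin n} ps → x ∈ ⋃ ps → ∃[ p ] (p ∈ₗ ps × x ∈ p)
x∈⋃⁻ [] x∈⊥ = contradiction x∈⊥ ∉⊥
x∈⋃⁻ (p ∷ ps) x∈ with x∈p∪q⁻ p (⋃ ps) x∈
... | inj₁ x∈p  = p , here refl , x∈p
... | inj₂ x∈ps with q , q∈ps , x∈q ← x∈⋃⁻ ps x∈ps = q , there q∈ps , x∈q

module _ (p : ℚ) (H : Hypergraph) where

  Fires : Subset (n H) → Subset (n H) → Set
  Fires F e = threshold p H e ℤ.≤ + ∣ e ∩ F ∣

  fires? : ∀ F → U.Decidable (Fires F)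
  fires? F e = threshold p H e ℤ.≤? + ∣ e ∩ F ∣

  fires-mono : ∀ {F G} e → F ⊆ G → Fires F e → Fires G e
  fires-mono e F⊆G fires = ℤ.≤-trans fires (ℤ.+≤+ (p⊆q⇒∣p∣≤∣q∣ e∩F⊆e∩G))
    where
    e∩F⊆e∩G : ∀ {x} → x ∈ e ∩ _ → x ∈ e ∩ _
    e∩F⊆e∩G x∈ with x∈e , x∈F ← x∈p∩q⁻ e _ x∈ = x∈p∩q⁺ (x∈e , F⊆G x∈F)

  ⊆-propagate : ∀ {F} → F ⊆ propagate p H F
  ⊆-propagate = p⊆p∪q _

  fires⇒⊆propagate : ∀ {F e} → e ∈ₗ edges H → Fires F e → e ⊆ propagate p H F
  fires⇒⊆propagate {F} e∈E fires =
    q⊆p∪q F _ ∘ x∈⋃⁺ (∈-filter⁺ (fires? F) e∈E fires)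

  x∈propagate⁻ : ∀ {F x} → x ∈ propagate p H F →
                 x ∈ F ⊎ ∃[ e ] (e ∈ₗ edges H × Fires F e × x ∈ e)
  x∈propagate⁻ {F} x∈ with x∈p∪q⁻ F _ x∈
  ... | inj₁ x∈F = inj₁ x∈F
  ... | inj₂ x∈⋃ with e , e∈firing , x∈e ← x∈⋃⁻ _ x∈⋃
                 with e∈E , fires ← ∈-filter⁻ (fires? F) {xs = edges H} e∈firing =
    inj₂ (e , e∈E , fires , x∈e)

  propagate-mono : ∀ {F G} → F ⊆ G → propagate p H F ⊆ propagate p H G
  propagate-mono F⊆G x∈ with x∈propagate⁻ x∈
  ... | inj₁ x∈F                    = ⊆-propagate (F⊆G x∈F)
  ... | inj₂ (e , e∈E , fires , x∈e) = fires⇒⊆propagate e∈E (fires-mono e F⊆G fires) x∈e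

  iter-⊆-closed : ∀ {S G} → propagate p H G ⊆ G → S ⊆ G → ∀ k → iter p H k S ⊆ G
  iter-⊆-closed closed S⊆G zero    = S⊆G
  iter-⊆-closed closed S⊆G (suc k) = closed ∘ propagate-mono (iter-⊆-closed closed S⊆G k)

  lazy⇒firing-edge-⊈ : ∀ {S F x} → IsLazyBurningSet p H S → S ⊆ F → x ∉ F →
                       ∃[ e ] (e ∈ₗ edges H × Fires F e × ¬ e ⊆ F)
  lazy⇒firing-edge-⊈ {F = F} {x} (k , iterₖS≡⊤) S⊆F x∉F with ⊆-or-∉ (propagate p H F) F
  ... | inj₁ closed =
    contradiction (iter-⊆-closed closed S⊆F k (subst (x ∈_) (sym iterₖS≡⊤) ∈⊤)) x∉F
  ... | inj₂ (y , y∈ , y∉F) with x∈propagate⁻ y∈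
  ...   | inj₁ y∈F = contradiction y∈F y∉F
  ...   | inj₂ (e , e∈E , fires , y∈e) = e , e∈E , fires , λ e⊆F → y∉F (e⊆F y∈e)

  burntEdgeCount : Subset (n H) → ℕ
  burntEdgeCount F = length (filter (_⊆? F) (edges H))

  burntEdgeCount-grows : ∀ {S F G x} → IsLazyBurningSet p H S → S ⊆ F → x ∉ F →
                         propagate p H F ⊆ G → burntEdgeCount F ℕ.< burntEdgeCount G
  burntEdgeCount-grows {F = F} {G} lazy S⊆F x∉F F⁺⊆G
    with e , e∈E , fires , e⊈F ← lazy⇒firing-edge-⊈ lazy S⊆F x∉F =
    length-filter-< (_⊆? F) (_⊆? G) (λ e⊆F → ⊆-trans e⊆F F⊆G)
      e∈E (⊆-trans (fires⇒⊆propagate e∈E fires) F⁺⊆G) e⊈F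
    where
    F⊆G : F ⊆ G
    F⊆G = ⊆-trans ⊆-propagate F⁺⊆G

  BurnsWithin : ℕ → Subset (n H) → Set
  BurnsWithin m F =
    ∃[ us ] (legalFrom p H F us × roundsFrom p H F us ≡ Subset.⊤ × length us ≤ m)

  burnsWithin-suc : ∀ {m F u} → u ∉ F → BurnsWithin m (propagate p H F ∪ ⁅ u ⁆) →
                    BurnsWithin (suc m) F
  burnsWithin-suc {u = u} u∉F (us , legal , burnt , length≤m) =
    u ∷ us , (u∉F , legal) , burnt , s≤s length≤m

  lazy⇒burnsWithin : ∀ {S} → IsLazyBurningSet p H S → ∀ m F → S ⊆ F →
                     length (edges H) ≤ m + burntEdgeCount F → BurnsWithin m F
  lazy⇒burnsWithin lazy m F S⊆F budget with ≡⊤-or-∉ F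
  ... | inj₁ F≡⊤ = [] , tt , F≡⊤ , z≤n
  lazy⇒burnsWithin lazy zero F S⊆F budget | inj₂ (x , x∉F) =
    contradiction budget (ℕ.<⇒≱ (ℕ.<-≤-trans
      (burntEdgeCount-grows lazy S⊆F x∉F ⊆-refl) (length-filter _ (edges H))))
  lazy⇒burnsWithin {S} lazy (suc m) F S⊆F budget | inj₂ (u , u∉F) =
    burnsWithin-suc u∉F (lazy⇒burnsWithin lazy m F′ S⊆F′ budget′)
    where
    F′ : Subset (n H)
    F′ = propagate p H F ∪ ⁅ u ⁆
    F⁺⊆F′ : propagate p H F ⊆ F′
    F⁺⊆F′ = p⊆p∪q ⁅ u ⁆
    S⊆F′ : S ⊆ F′
    S⊆F′ = F⁺⊆F′ ∘ ⊆-propagate ∘ S⊆F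
    budget′ : length (edges H) ≤ m + burntEdgeCount F′
    budget′ = begin
      length (edges H)              ≤⟨ budget ⟩
      suc (m + burntEdgeCount F)    ≡⟨ ℕ.+-suc m _ ⟨
      m + suc (burntEdgeCount F)    ≤⟨ ℕ.+-monoʳ-≤ m grows ⟩
      m + burntEdgeCount F′         ∎
      where
      open ≤-Reasoning
      grows : burntEdgeCount F ℕ.< burntEdgeCount F′
      grows = burntEdgeCount-grows lazy S⊆F u∉F F⁺⊆F′

lemma2p11 : (p : ℚ) → 0ℚ < p → p < 1ℚ → (H : Hypergraph) →
    lazyBurningNumber≡ p H 1 → burningNumber≤ p H (suc (length (edges H)))
lemma2p11 p _ _ H ((S , lazy , ∣S∣≡1) , _)
  with v , refl ← ∣p∣≡1⇒p≡⁅x⁆ S ∣S∣≡1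
  with us , legal , burnt , length≤ ←
         lazy⇒burnsWithin p H lazy (length (edges H)) ⁅ v ⁆ ⊆-refl (ℕ.m≤m+n _ _) =
  v ∷ us , ((∉⊥ , legal) , burnt) , s≤s length≤
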